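{- Let $\mathcal{F}$ be an annotated signature. Suppose that for each constructor $c$ and each declaration $A_1^{\vec u_1}\times\cdots\times A_n^{\vec u_n}\xrightarrow{p}C^{\vec w}\in\mathcal{F}(c)$ with $\mathrm{len}(\vec w)\geqslant 1$, there exist resource annotations $\vec r_1,\dots,\vec r_n$ such that $\vec u_i\leqslant\vec w+\vec r_i$, $\max\vec r_i\leqslant\max\vec w=:r$, $p\leqslant r$ and $\mathrm{len}(\vec r_i)<\mathrm{len}(\vec w)=:k$. Then for every value $v$ of base type $C$ and every annotation $\vec w$, $\Phi(v:C^{\vec w})\leqslant r\,|v|^{k}$, where $r=\max\vec w$ and $k=\mathrm{len}(\vec w)$.
   Context: $\mathcal{C}$ is a finite set of constructor symbols, $S$ a finite set of base types; each constructor has a base type declaration $A_1\times\cdots\times A_n\to C$. Values are ground terms built from constructors, respecting declarations; $|v|$ denotes the number of symbols of $v$. A resource annotation is a finite vector $\vec p=(p_1,\dots,p_k)$ of non-negative rationals, $\mathrm{len}(\vec p)=k$, $\max\vec p=\max_ip_i$ (with $\max()=0$); $\leqslant$ and $+$ on annotations are componentwise after padding the shorter vector with zeros. An annotated type $A^{\vec p}$ is a base type with an annotation. An annotated signature $\mathcal{F}$ maps each constructor $c$ with base declaration $A_1\times\cdots\times A_n\to C$ to a nonempty set of annotated declarations $A_1^{\vec u_1}\times\cdots\times A_n^{\vec u_n}\xrightarrow{p}C^{\vec w}$ ($p\geqslant0$) such that for each annotation $\vec w$ there is exactly one declaration with result $C^{\vec w}$, and $\mathcal{F}(c)$ is closed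 under multiplying all annotations and the cost by any $\lambda\geqslant0$ and under componentwise addition of two declarations. The potential of a value $v=c(v_1,\dots,v_n)$ at annotated type $C$ is $\Phi(v:C)=p+\sum_i\Phi(v_i:A_i)$, where $A_1\times\cdots\times A_n\xrightarrow{p}C$ is the unique declaration of $c$ with result $C$. -}

module Defs where

open import Data.Nat as ℕ using (ℕ; zero; suc)
open import Data.Integer using (+_)
open import Data.Rational as ℚ using (ℚ; 0ℚ)
open import Data.List using (List; []; _∷_; length; map; foldr)
open import Data.List.Relation.Unary.All using (All; []; _∷_)
open import Data.Fin using (Fin)
open import Data.Product using (_×_; Σ; ∃)
open import Data.Unit using (⊤)
open import Relation.Binary.PropositionalEquality using (_≡_)

Annot : Set
Annot = List ℚ

Ann : Annot → Set
Ann = All (0ℚ ℚ.≤_)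

-- componentwise order after padding the shorter vector with zeros
infix 4 _≤ₐ_
_≤ₐ_ : Annot → Annot → Set
[]       ≤ₐ []       = ⊤
(x ∷ xs) ≤ₐ []       = (x ℚ.≤ 0ℚ) × (xs ≤ₐ [])
[]       ≤ₐ (y ∷ ys) = (0ℚ ℚ.≤ y) × ([] ≤ₐ ys)
(x ∷ xs) ≤ₐ (y ∷ ys) = (x ℚ.≤ y) × (xs ≤ₐ ys)

infixl 6 _⊕_
_⊕_ : Annot → Annot → Annot
[]       ⊕ ys       = ys
(x ∷ xs) ⊕ []       = x ∷ xs
(x ∷ xs) ⊕ (y ∷ ys) = (x ℚ.+ y) ∷ (xs ⊕ ys)

infixl 7 _·_
_·_ : ℚ → Annot → Annot
λ' · xs = map (λ' ℚ.*_) xs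

-- max of a vector, with max () = 0
maxₐ : Annot → ℚ
maxₐ = foldr ℚ._⊔_ 0ℚ

lenₐ : Annot → ℕ
lenₐ = length

-- Base signature: finitely many base types (Fin nS) and constructors
-- (Fin nC); constructor c : A₁ × ⋯ × Aₙ → C with args c = [A₁,…,Aₙ],
-- res c = C.

record Signature : Set where
  field
    nS   : ℕ
    nC   : ℕ
    args : Fin nC → List (Fin nS)
    res  : Fin nC → Fin nS

module _ (Σ' : Signature) where
  open Signature Σ'

  data Val : Fin nS → Set where
    con : (c : Fin nC) → All Val (args c) → Val (res c)

  mutual
    size : ∀ {A} → Val A → ℕ
    size (con c vs) = suc (sizes vs)

    sizes : ∀ {As} → All Val As → ℕ
    sizes []       = 0
    sizes (v ∷ vs) = size v ℕ.+ sizes vs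

  ArgAnns : List (Fin nS) → Set
  ArgAnns = All (λ _ → Annot)

  -- An annotated declaration A₁^{u₁} × ⋯ × Aₙ^{uₙ} →^p C^w of c,
  -- without its result annotation w (which indexes it, see below).
  record Decl (c : Fin nC) : Set where
    constructor mkDecl
    field
      argAnn : ArgAnns (args c)
      cost   : ℚ

  mapAnns : ∀ {As} → (Annot → Annot) → ArgAnns As → ArgAnns As
  mapAnns f []       = []
  mapAnns f (u ∷ us) = f u ∷ mapAnns f us

  zipAnns : ∀ {As} → ArgAnns As → ArgAnns As → ArgAnns As
  zipAnns []       []       = []
  zipAnns (u ∷ us) (u' ∷ us') = (u ⊕ u') ∷ zipAnns us us'

  Every : ∀ {As} → (Annot → Set) → ArgAnns As → Set
  Every P []       = ⊤
  Every P (u ∷ us) = P u × Every P us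

  scaleDecl : ∀ {c} → ℚ → Decl c → Decl c
  scaleDecl λ' (mkDecl us p) = mkDecl (mapAnns (λ' ·_) us) (λ' ℚ.* p)

  addDecl : ∀ {c} → Decl c → Decl c → Decl c
  addDecl (mkDecl us p) (mkDecl us' p') = mkDecl (zipAnns us us') (p ℚ.+ p')

  -- Since for each result annotation w there is
  -- exactly one declaration with result C^w, F(c) is given by the
  -- function w ↦ decl c w (for non-negative w); F(c) = { decl c w | Ann w }.
  record AnnotatedSignature : Set where
    field
      decl : (c : Fin nC) → Annot → Decl c
      decl-ann  : ∀ c w → Ann w → Every Ann (Decl.argAnn (decl c w))
      decl-cost : ∀ c w → Ann w → 0ℚ ℚ.≤ Decl.cost (decl c w)
      decl-scale : ∀ c w (λ' : ℚ) → Ann w → 0ℚ ℚ.≤ λ' →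
                   decl c (λ' · w) ≡ scaleDecl λ' (decl c w)
      decl-add : ∀ c w w' → Ann w → Ann w' →
                 decl c (w ⊕ w') ≡ addDecl (decl c w) (decl c w')

  module _ (F : AnnotatedSignature) where
    open AnnotatedSignature F

    mutual
      Φ : ∀ {A} → Val A → Annot → ℚ
      Φ (con c vs) w = Decl.cost (decl c w) ℚ.+ Φs vs (Decl.argAnn (decl c w))

      Φs : ∀ {As} → All Val As → ArgAnns As → ℚ
      Φs []       []       = 0ℚ
      Φs (v ∷ vs) (u ∷ us) = Φ v u ℚ.+ Φs vs us

ℕ→ℚ : ℕ → ℚ
ℕ→ℚ n = (+ n) ℚ./ 1

-- The potential is additive and monotone in the annotation and vanishes on
-- zero annotations, because the declarations of a constructor depend
-- linearly on the result annotation. The bound is proved by induction on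
-- k = len w and, inside, on v = c(v₁,…,vₙ). Writing sᵢ = |vᵢ| and S = Σ sᵢ,
-- the hypothesis splits each argument annotation as uᵢ ≤ w + rᵢ with rᵢ of
-- smaller length, so
--   Φ(v : w) ≤ p + Σ (Φ(vᵢ : w) + Φ(vᵢ : rᵢ)) ≤ r (1 + Σ (sᵢᵏ + sᵢᵏ⁻¹)),
-- where the sᵢᵏ⁻¹ terms are absent when k = 1 (then every rᵢ is empty).
-- Superadditivity of powers and 1 + Sᵏ + Sᵏ⁻¹ ≤ (1 + S)ᵏ give r |v|ᵏ.

module Submission where

open import Defs
open import Data.Nat as ℕ using (ℕ; zero; suc; _^_)
import Data.Nat.Properties as ℕₚ
open import Data.Nat.Coprimality using (1-coprimeTo) renaming (sym to coprime-sym)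
open import Data.Integer as ℤ using (+_)
import Data.Integer.Properties as ℤₚ
open import Data.Rational as ℚ using (ℚ; 0ℚ)
import Data.Rational.Properties as ℚₚ
import Data.Rational.Solver as ℚSolver
open import Data.Fin using (Fin)
open import Data.Product using (_×_; ∃; ∃₂; _,_; proj₁; proj₂)
open import Data.List using (List; []; _∷_; length; map)
open import Data.Nat.ListAction using (sum)
open import Data.List.Relation.Unary.All as All using (All; []; _∷_)
open import Algebra.Bundles using (CommutativeMonoid)
import Algebra.Properties.CommutativeSemigroup as CommutativeSemigroupProperties
open import Relation.Binary.PropositionalEquality

^-superadditive : ∀ n a b → a ^ suc n ℕ.+ b ^ suc n ℕ.≤ (a ℕ.+ b) ^ suc n
^-superadditive n a b = begin
  a ℕ.* a ^ n ℕ.+ b ℕ.* b ^ n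
    ≤⟨ ℕₚ.+-mono-≤ (ℕₚ.*-monoʳ-≤ a (ℕₚ.^-monoˡ-≤ n (ℕₚ.m≤m+n a b)))
                   (ℕₚ.*-monoʳ-≤ b (ℕₚ.^-monoˡ-≤ n (ℕₚ.m≤n+m b a))) ⟩
  a ℕ.* (a ℕ.+ b) ^ n ℕ.+ b ℕ.* (a ℕ.+ b) ^ n
    ≡⟨ ℕₚ.*-distribʳ-+ ((a ℕ.+ b) ^ n) a b ⟨
  (a ℕ.+ b) ^ suc n ∎
  where open ℕₚ.≤-Reasoning

-- s ^ m, except that it vanishes at m = 0: annotations of length 0 carry no potential.
infixr 8 _^⁺_
_^⁺_ : ℕ → ℕ → ℕ
s ^⁺ zero  = 0
s ^⁺ suc m = s ^ suc m

^⁺-superadditive : ∀ m a b → a ^⁺ m ℕ.+ b ^⁺ m ℕ.≤ (a ℕ.+ b) ^⁺ m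
^⁺-superadditive zero    a b = ℕ.z≤n
^⁺-superadditive (suc m) a b = ^-superadditive m a b

-- Up to the factor max w, the bound on the potential of a child of size s
-- at an annotation dominated by w ⊕ r, where len w = suc m > len r.
childCost : ℕ → ℕ → ℕ
childCost m s = s ^ suc m ℕ.+ s ^⁺ m

childCost-superadditive : ∀ m a b → childCost m a ℕ.+ childCost m b ℕ.≤ childCost m (a ℕ.+ b)
childCost-superadditive m a b = begin
  (a ^ suc m ℕ.+ a ^⁺ m) ℕ.+ (b ^ suc m ℕ.+ b ^⁺ m) ≡⟨ interchange (a ^ suc m) (a ^⁺ m) (b ^ suc m) (b ^⁺ m) ⟩
  (a ^ suc m ℕ.+ b ^ suc m) ℕ.+ (a ^⁺ m ℕ.+ b ^⁺ m) ≤⟨ ℕₚ.+-mono-≤ (^-superadditive m a b) (^⁺-superadditive m a b) ⟩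
  childCost m (a ℕ.+ b)                             ∎
  where open ℕₚ.≤-Reasoning
        open CommutativeSemigroupProperties ℕₚ.+-commutativeSemigroup using (interchange)

suc-childCost≤suc^ : ∀ m s → suc (childCost m s) ℕ.≤ suc s ^ suc m
suc-childCost≤suc^ zero    s = ℕ.s≤s (ℕₚ.≤-reflexive (ℕₚ.+-identityʳ (s ^ 1)))
suc-childCost≤suc^ (suc m) s = begin
  suc (s ^ suc (suc m) ℕ.+ s ^ suc m)  ≡⟨ cong suc (ℕₚ.+-comm (s ^ suc (suc m)) (s ^ suc m)) ⟩
  suc (s ^ suc m) ℕ.+ s ^ suc (suc m)  ≤⟨ ℕₚ.+-mono-≤ 1+s^≤suc^ (ℕₚ.*-monoʳ-≤ s (ℕₚ.^-monoˡ-≤ (suc m) (ℕₚ.n≤1+n s))) ⟩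
  suc s ^ suc m ℕ.+ s ℕ.* suc s ^ suc m ∎
  where
  open ℕₚ.≤-Reasoning
  1+s^≤suc^ : suc (s ^ suc m) ℕ.≤ suc s ^ suc m
  1+s^≤suc^ = subst (λ x → x ℕ.+ s ^ suc m ℕ.≤ suc s ^ suc m) (ℕₚ.^-zeroˡ (suc m)) (^-superadditive m 1 s)

sum-superadditive : (f : ℕ → ℕ) → (∀ a b → f a ℕ.+ f b ℕ.≤ f (a ℕ.+ b)) →
                    ∀ xs → sum (map f xs) ℕ.≤ f (sum xs)
sum-superadditive f f-super []       = ℕ.z≤n
sum-superadditive f f-super (x ∷ xs) =
  ℕₚ.≤-trans (ℕₚ.+-monoʳ-≤ (f x) (sum-superadditive f f-super xs)) (f-super x (sum xs))

ℕ→ℚ≡mkℚ : ∀ n → ℕ→ℚ n ≡ ℚ.mkℚ (+ n) 0 (coprime-sym (1-coprimeTo n))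
ℕ→ℚ≡mkℚ n = ℚₚ.normalize-coprime (coprime-sym (1-coprimeTo n))

ℕ→ℚ-+ : ∀ a b → ℕ→ℚ (a ℕ.+ b) ≡ ℕ→ℚ a ℚ.+ ℕ→ℚ b
ℕ→ℚ-+ a b rewrite ℕ→ℚ≡mkℚ a | ℕ→ℚ≡mkℚ b =
  cong₂ (λ x y → (x ℤ.+ y) ℚ./ 1) (sym (ℤₚ.*-identityʳ (+ a))) (sym (ℤₚ.*-identityʳ (+ b)))

ℕ→ℚ-mono-≤ : ∀ {a b} → a ℕ.≤ b → ℕ→ℚ a ℚ.≤ ℕ→ℚ b
ℕ→ℚ-mono-≤ {a} {b} a≤b rewrite ℕ→ℚ≡mkℚ a | ℕ→ℚ≡mkℚ b =
  ℚ.*≤* (subst₂ ℤ._≤_ (sym (ℤₚ.*-identityʳ (+ a))) (sym (ℤₚ.*-identityʳ (+ b))) (ℤ.+≤+ a≤b))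

ℕ→ℚ-nonneg : ∀ n → 0ℚ ℚ.≤ ℕ→ℚ n
ℕ→ℚ-nonneg n = ℕ→ℚ-mono-≤ (ℕ.z≤n {n})

*-ℕ→ℚ-+ : ∀ r a b → r ℚ.* ℕ→ℚ a ℚ.+ r ℚ.* ℕ→ℚ b ≡ r ℚ.* ℕ→ℚ (a ℕ.+ b)
*-ℕ→ℚ-+ r a b = trans (sym (ℚₚ.*-distribˡ-+ r (ℕ→ℚ a) (ℕ→ℚ b))) (cong (r ℚ.*_) (sym (ℕ→ℚ-+ a b)))

+-nonneg : ∀ {p q} → 0ℚ ℚ.≤ p → 0ℚ ℚ.≤ q → 0ℚ ℚ.≤ p ℚ.+ q
+-nonneg 0≤p 0≤q = ℚₚ.+-mono-≤ 0≤p 0≤q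

p≤p+q : ∀ {p q} → 0ℚ ℚ.≤ q → p ℚ.≤ p ℚ.+ q
p≤p+q {p} 0≤q = ℚₚ.≤-trans (ℚₚ.≤-reflexive (sym (ℚₚ.+-identityʳ p))) (ℚₚ.+-monoʳ-≤ p 0≤q)

p≤q⇒0≤q-p : ∀ {p q} → p ℚ.≤ q → 0ℚ ℚ.≤ q ℚ.- p
p≤q⇒0≤q-p {p} p≤q = ℚₚ.≤-trans (ℚₚ.≤-reflexive (sym (ℚₚ.+-inverseʳ p))) (ℚₚ.+-monoˡ-≤ (ℚ.- p) p≤q)

*-mono-≤-nonneg : ∀ {p q r s} → 0ℚ ℚ.≤ p → 0ℚ ℚ.≤ r → p ℚ.≤ q → r ℚ.≤ s → p ℚ.* r ℚ.≤ q ℚ.* s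
*-mono-≤-nonneg {q = q} {r = r} 0≤p 0≤r p≤q r≤s = ℚₚ.≤-trans
  (ℚₚ.*-monoʳ-≤-nonNeg r {{ℚ.nonNegative 0≤r}} p≤q)
  (ℚₚ.*-monoˡ-≤-nonNeg q {{ℚ.nonNegative (ℚₚ.≤-trans 0≤p p≤q)}} r≤s)

Null : Annot → Set
Null = All (_≡ 0ℚ)

Null⇒Ann : ∀ {z} → Null z → Ann z
Null⇒Ann = All.map (λ z≡0 → ℚₚ.≤-reflexive (sym z≡0))

0·-Null : ∀ u → Null (0ℚ · u)
0·-Null []       = []
0·-Null (x ∷ xs) = ℚₚ.*-zeroˡ x ∷ 0·-Null xs

0·-fixes-Null : ∀ {z} → Null z → 0ℚ · z ≡ z
0·-fixes-Null []                = refl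
0·-fixes-Null {x ∷ _} (x≡0 ∷ z) = cong₂ _∷_ (trans (ℚₚ.*-zeroˡ x) (sym x≡0)) (0·-fixes-Null z)

⊕-Ann : ∀ {u w} → Ann u → Ann w → Ann (u ⊕ w)
⊕-Ann []       aw       = aw
⊕-Ann (p ∷ au) []       = p ∷ au
⊕-Ann (p ∷ au) (q ∷ aw) = +-nonneg p q ∷ ⊕-Ann au aw

≤ₐ[]⇒Null : ∀ {u} → Ann u → u ≤ₐ [] → Null u
≤ₐ[]⇒Null []       _          = []
≤ₐ[]⇒Null (p ∷ au) (q , u≤[]) = ℚₚ.≤-antisym q p ∷ ≤ₐ[]⇒Null au u≤[]

-- The null padding z is needed because u may be longer than w.
≤ₐ⇒⊕-balanced : ∀ {u w} → Ann u → Ann w → u ≤ₐ w →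
                ∃₂ λ d z → Ann d × Null z × (u ⊕ d ≡ w ⊕ z)
≤ₐ⇒⊕-balanced {[]}     {[]}     _ _  _ = [] , [] , [] , [] , refl
≤ₐ⇒⊕-balanced {x ∷ xs} {[]}     au _ u≤w = [] , x ∷ xs , [] , ≤ₐ[]⇒Null au u≤w , refl
≤ₐ⇒⊕-balanced {[]}     {y ∷ ys} _ aw _ = y ∷ ys , [] , aw , [] , refl
≤ₐ⇒⊕-balanced {x ∷ xs} {y ∷ ys} (_ ∷ au) (_ ∷ aw) (x≤y , xs≤ys)
  with ≤ₐ⇒⊕-balanced au aw xs≤ys
... | d , z , ad , null , eq =
  (y ℚ.- x) ∷ d , 0ℚ ∷ z , p≤q⇒0≤q-p x≤y ∷ ad , refl ∷ null , cong₂ _∷_ (x+[y-x]≡y+0 x y) eq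
  where
  x+[y-x]≡y+0 : ∀ x y → x ℚ.+ (y ℚ.- x) ≡ y ℚ.+ 0ℚ
  x+[y-x]≡y+0 = solve 2 (λ x y → x :+ (y :- x) := y :+ con 0ℚ) refl
    where open ℚSolver.+-*-Solver

maxₐ-nonneg : ∀ {w} → Ann w → 0ℚ ℚ.≤ maxₐ w
maxₐ-nonneg []                = ℚₚ.≤-refl
maxₐ-nonneg {x ∷ _} (_ ∷ aw) = ℚₚ.p≤q⇒p≤r⊔q x (maxₐ-nonneg aw)

maxₐ*^lenₐ≤*^⁺ : ∀ {m r ρ s} .{{_ : ℕ.NonZero s}} → Ann ρ → lenₐ ρ ℕ.< suc m →
                 maxₐ ρ ℚ.≤ r → 0ℚ ℚ.≤ r →
                 maxₐ ρ ℚ.* ℕ→ℚ (s ^ lenₐ ρ) ℚ.≤ r ℚ.* ℕ→ℚ (s ^⁺ m)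
maxₐ*^lenₐ≤*^⁺ {m} {r} {[]} {s} _ _ _ 0≤r = ℚₚ.≤-trans
  (ℚₚ.≤-reflexive (ℚₚ.*-zeroˡ (ℕ→ℚ 1)))
  (ℚₚ.≤-trans (ℚₚ.≤-reflexive (sym (ℚₚ.*-zeroʳ r)))
              (ℚₚ.*-monoˡ-≤-nonNeg r {{ℚ.nonNegative 0≤r}} (ℕ→ℚ-nonneg (s ^⁺ m))))
maxₐ*^lenₐ≤*^⁺ {suc m} {ρ = _ ∷ ρ} {s} aρ (ℕ.s≤s lenρ≤m) max≤r _ =
  *-mono-≤-nonneg (maxₐ-nonneg aρ) (ℕ→ℚ-nonneg (s ^ suc (length ρ))) max≤r
                  (ℕ→ℚ-mono-≤ (ℕₚ.^-monoʳ-≤ s lenρ≤m))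

module _ (Σ' : Signature) (F : AnnotatedSignature Σ') where
  open Signature Σ'
  open AnnotatedSignature F

  ϕ : ∀ {A} → Val Σ' A → Annot → ℚ
  ϕ = Φ Σ' F

  ϕs : ∀ {As} → All (Val Σ') As → ArgAnns Σ' As → ℚ
  ϕs = Φs Σ' F

  mutual
    Φ-nonneg : ∀ {A} (v : Val Σ' A) {w} → Ann w → 0ℚ ℚ.≤ ϕ v w
    Φ-nonneg (con c vs) {w} aw = +-nonneg (decl-cost c w aw) (Φs-nonneg vs (decl-ann c w aw))

    Φs-nonneg : ∀ {As} (vs : All (Val Σ') As) {us} → Every Σ' Ann us → 0ℚ ℚ.≤ ϕs vs us
    Φs-nonneg []       {[]}    _         = ℚₚ.≤-refl
    Φs-nonneg (v ∷ vs) {_ ∷ _} (au , aus) = +-nonneg (Φ-nonneg v au) (Φs-nonneg vs aus)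

  mutual
    Φ-null : ∀ {A} (v : Val Σ' A) {z} → Null z → ϕ v z ≡ 0ℚ
    Φ-null (con c vs) {z} null = begin
      Decl.cost (decl c z) ℚ.+ ϕs vs (Decl.argAnn (decl c z))
        ≡⟨ cong (λ d → Decl.cost d ℚ.+ ϕs vs (Decl.argAnn d)) decl-null ⟩
      0ℚ ℚ.* Decl.cost (decl c z) ℚ.+ ϕs vs (mapAnns Σ' (0ℚ ·_) (Decl.argAnn (decl c z)))
        ≡⟨ cong₂ ℚ._+_ (ℚₚ.*-zeroˡ (Decl.cost (decl c z))) (Φs-0· vs (Decl.argAnn (decl c z))) ⟩
      0ℚ ℚ.+ 0ℚ
        ≡⟨ ℚₚ.+-identityʳ 0ℚ ⟩
      0ℚ ∎
      where
      open ≡-Reasoning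
      decl-null : decl c z ≡ scaleDecl Σ' 0ℚ (decl c z)
      decl-null = trans (cong (decl c) (sym (0·-fixes-Null null)))
                        (decl-scale c z 0ℚ (Null⇒Ann null) ℚₚ.≤-refl)

    Φs-0· : ∀ {As} (vs : All (Val Σ') As) us → ϕs vs (mapAnns Σ' (0ℚ ·_) us) ≡ 0ℚ
    Φs-0· []       []       = refl
    Φs-0· (v ∷ vs) (u ∷ us) =
      trans (cong₂ ℚ._+_ (Φ-null v (0·-Null u)) (Φs-0· vs us)) (ℚₚ.+-identityʳ 0ℚ)

  open CommutativeSemigroupProperties
    (CommutativeMonoid.commutativeSemigroup ℚₚ.+-0-commutativeMonoid) using (interchange)

  mutual
    Φ-⊕ : ∀ {A} (v : Val Σ' A) {w w'} → Ann w → Ann w' → ϕ v (w ⊕ w') ≡ ϕ v w ℚ.+ ϕ v w'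
    Φ-⊕ (con c vs) {w} {w'} aw aw' = begin
      Decl.cost (decl c (w ⊕ w')) ℚ.+ ϕs vs (Decl.argAnn (decl c (w ⊕ w')))
        ≡⟨ cong (λ d → Decl.cost d ℚ.+ ϕs vs (Decl.argAnn d)) (decl-add c w w' aw aw') ⟩
      (p ℚ.+ p') ℚ.+ ϕs vs (zipAnns Σ' us us')
        ≡⟨ cong ((p ℚ.+ p') ℚ.+_) (Φs-⊕ vs (decl-ann c w aw) (decl-ann c w' aw')) ⟩
      (p ℚ.+ p') ℚ.+ (ϕs vs us ℚ.+ ϕs vs us')
        ≡⟨ interchange p p' (ϕs vs us) (ϕs vs us') ⟩
      (p ℚ.+ ϕs vs us) ℚ.+ (p' ℚ.+ ϕs vs us') ∎
      where
      open ≡-Reasoning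
      p = Decl.cost (decl c w)
      p' = Decl.cost (decl c w')
      us = Decl.argAnn (decl c w)
      us' = Decl.argAnn (decl c w')

    Φs-⊕ : ∀ {As} (vs : All (Val Σ') As) {us us'} → Every Σ' Ann us → Every Σ' Ann us' →
           ϕs vs (zipAnns Σ' us us') ≡ ϕs vs us ℚ.+ ϕs vs us'
    Φs-⊕ []       {[]}    {[]}      _          _            = sym (ℚₚ.+-identityʳ 0ℚ)
    Φs-⊕ (v ∷ vs) {u ∷ us} {u' ∷ us'} (au , aus) (au' , aus') =
      trans (cong₂ ℚ._+_ (Φ-⊕ v au au') (Φs-⊕ vs aus aus'))
            (interchange (ϕ v u) (ϕ v u') (ϕs vs us) (ϕs vs us'))

  Φ-mono : ∀ {A} (v : Val Σ' A) {u w} → Ann u → Ann w → u ≤ₐ w → ϕ v u ℚ.≤ ϕ v w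
  Φ-mono v {u} {w} au aw u≤w with ≤ₐ⇒⊕-balanced au aw u≤w
  ... | d , z , ad , null , u⊕d≡w⊕z = begin
    ϕ v u             ≤⟨ p≤p+q (Φ-nonneg v ad) ⟩
    ϕ v u ℚ.+ ϕ v d   ≡⟨ Φ-⊕ v au ad ⟨
    ϕ v (u ⊕ d)       ≡⟨ cong (ϕ v) u⊕d≡w⊕z ⟩
    ϕ v (w ⊕ z)       ≡⟨ Φ-⊕ v aw (Null⇒Ann null) ⟩
    ϕ v w ℚ.+ ϕ v z   ≡⟨ cong (ϕ v w ℚ.+_) (Φ-null v null) ⟩
    ϕ v w ℚ.+ 0ℚ      ≡⟨ ℚₚ.+-identityʳ (ϕ v w) ⟩
    ϕ v w             ∎
    where open ℚₚ.≤-Reasoning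

  Shifted : Annot → Annot → Set
  Shifted w u = ∃ λ r → Ann r × (u ≤ₐ w ⊕ r) × (maxₐ r ℚ.≤ maxₐ w) × (lenₐ r ℕ.< lenₐ w)

  ShiftCondition : Set
  ShiftCondition = ∀ (c : Fin nC) (w : Annot) → Ann w → 1 ℕ.≤ lenₐ w →
    Every Σ' (Shifted w) (Decl.argAnn (decl c w)) × (Decl.cost (decl c w) ℚ.≤ maxₐ w)

  PolynomialBound : Annot → Set
  PolynomialBound w = ∀ {A} (v : Val Σ' A) → ϕ v w ℚ.≤ maxₐ w ℚ.* ℕ→ℚ (size Σ' v ^ lenₐ w)

  sizeList : ∀ {As} → All (Val Σ') As → List ℕ
  sizeList = All.reduce (size Σ')

  sizes≡sum-sizeList : ∀ {As} (vs : All (Val Σ') As) → sizes Σ' vs ≡ sum (sizeList vs)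
  sizes≡sum-sizeList []       = refl
  sizes≡sum-sizeList (v ∷ vs) = cong (size Σ' v ℕ.+_) (sizes≡sum-sizeList vs)

  module PolynomialBoundStep
    (shift : ShiftCondition) (x : ℚ) (xs : Annot) (aw : Ann (x ∷ xs))
    (shorter : ∀ ρ → Ann ρ → lenₐ ρ ℕ.< suc (length xs) → PolynomialBound ρ)
    where

    w : Annot
    w = x ∷ xs

    m : ℕ
    m = length xs

    r : ℚ
    r = maxₐ w

    0≤r : 0ℚ ℚ.≤ r
    0≤r = maxₐ-nonneg aw

    open ℚₚ.≤-Reasoning

    mutual
      bound : PolynomialBound w
      bound (con c vs) = begin
        Decl.cost (decl c w) ℚ.+ ϕs vs (Decl.argAnn (decl c w))
          ≤⟨ ℚₚ.+-mono-≤ (proj₂ (shift c w aw (ℕ.s≤s ℕ.z≤n)))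
                         (children-bound vs (proj₁ (shift c w aw (ℕ.s≤s ℕ.z≤n))) (decl-ann c w aw)) ⟩
        r ℚ.+ r ℚ.* ℕ→ℚ total
          ≡⟨ cong (ℚ._+ r ℚ.* ℕ→ℚ total) (ℚₚ.*-identityʳ r) ⟨
        r ℚ.* ℕ→ℚ 1 ℚ.+ r ℚ.* ℕ→ℚ total
          ≡⟨ *-ℕ→ℚ-+ r 1 total ⟩
        r ℚ.* ℕ→ℚ (suc total)
          ≤⟨ ℚₚ.*-monoˡ-≤-nonNeg r {{ℚ.nonNegative 0≤r}} (ℕ→ℚ-mono-≤ suc-total≤) ⟩
        r ℚ.* ℕ→ℚ (suc (sizes Σ' vs) ^ suc m) ∎
        where
        total : ℕ
        total = sum (map (childCost m) (sizeList vs))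
        suc-total≤ : suc total ℕ.≤ suc (sizes Σ' vs) ^ suc m
        suc-total≤ = ℕₚ.≤-trans
          (ℕ.s≤s (subst (total ℕ.≤_) (cong (childCost m) (sym (sizes≡sum-sizeList vs)))
                        (sum-superadditive (childCost m) (childCost-superadditive m) (sizeList vs))))
          (suc-childCost≤suc^ m (sizes Σ' vs))

      children-bound : ∀ {As} (vs : All (Val Σ') As) {us} → Every Σ' (Shifted w) us → Every Σ' Ann us →
                       ϕs vs us ℚ.≤ r ℚ.* ℕ→ℚ (sum (map (childCost m) (sizeList vs)))
      children-bound []       {[]}    _        _          = ℚₚ.≤-reflexive (sym (ℚₚ.*-zeroʳ r))
      children-bound (v ∷ vs) {u ∷ us} (sh , shs) (au , aus) = begin
        ϕ v u ℚ.+ ϕs vs us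
          ≤⟨ ℚₚ.+-mono-≤ (child-bound v sh au) (children-bound vs shs aus) ⟩
        r ℚ.* ℕ→ℚ (childCost m (size Σ' v)) ℚ.+ r ℚ.* ℕ→ℚ (sum (map (childCost m) (sizeList vs)))
          ≡⟨ *-ℕ→ℚ-+ r (childCost m (size Σ' v)) (sum (map (childCost m) (sizeList vs))) ⟩
        r ℚ.* ℕ→ℚ (sum (map (childCost m) (sizeList (v ∷ vs)))) ∎

      child-bound : ∀ {A} (v : Val Σ' A) {u} → Shifted w u → Ann u → ϕ v u ℚ.≤ r ℚ.* ℕ→ℚ (childCost m (size Σ' v))
      child-bound v@(con _ _) {u} (ρ , aρ , u≤w⊕ρ , maxρ≤r , lenρ<) au = begin
        ϕ v u
          ≤⟨ Φ-mono v au (⊕-Ann aw aρ) u≤w⊕ρ ⟩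
        ϕ v (w ⊕ ρ)
          ≡⟨ Φ-⊕ v aw aρ ⟩
        ϕ v w ℚ.+ ϕ v ρ
          ≤⟨ ℚₚ.+-mono-≤ (bound v) (ℚₚ.≤-trans (shorter ρ aρ lenρ< v) (maxₐ*^lenₐ≤*^⁺ aρ lenρ< maxρ≤r 0≤r)) ⟩
        r ℚ.* ℕ→ℚ (size Σ' v ^ suc m) ℚ.+ r ℚ.* ℕ→ℚ (size Σ' v ^⁺ m)
          ≡⟨ *-ℕ→ℚ-+ r (size Σ' v ^ suc m) (size Σ' v ^⁺ m) ⟩
        r ℚ.* ℕ→ℚ (childCost m (size Σ' v)) ∎

  polynomial-bound : ShiftCondition → ∀ n w → lenₐ w ℕ.≤ n → Ann w → PolynomialBound w
  polynomial-bound shift n       []       _       _  v =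
    ℚₚ.≤-reflexive (trans (Φ-null v []) (sym (ℚₚ.*-zeroˡ (ℕ→ℚ 1))))
  polynomial-bound shift (suc n) (x ∷ xs) (ℕ.s≤s len≤n) aw =
    PolynomialBoundStep.bound shift x xs aw
      (λ ρ aρ lenρ< → polynomial-bound shift n ρ (ℕₚ.≤-trans (ℕₚ.≤-pred lenρ<) len≤n) aρ)

theorem2 : (Σ' : Signature) → (F : AnnotatedSignature Σ') →
    (∀ (c : Fin (Signature.nC Σ')) (w : Annot) → Ann w → 1 ℕ.≤ lenₐ w →
      Every Σ' (λ u → ∃ λ r → Ann r × (u ≤ₐ w ⊕ r) × (maxₐ r ℚ.≤ maxₐ w) × (lenₐ r ℕ.< lenₐ w))
        (Decl.argAnn (AnnotatedSignature.decl F c w))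
      × (Decl.cost (AnnotatedSignature.decl F c w) ℚ.≤ maxₐ w)) →
    ∀ {C : Fin (Signature.nS Σ')} (v : Val Σ' C) (w : Annot) → Ann w →
      Φ Σ' F v w ℚ.≤ maxₐ w ℚ.* ℕ→ℚ (size Σ' v ^ lenₐ w)
theorem2 Σ' F shift v w aw = polynomial-bound Σ' F shift (lenₐ w) w ℕₚ.≤-refl aw v
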